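{- Let $\langle\phi,\vec a\rangle$ be a loop with $\phi(\vec x)\equiv\bigwedge_{i=1}^k C_i$ in CNF, where each clause $C_i$ contains an inequation $e_i(\vec x)>0$ (as one of its disjuncts) such that \[ e_i(\vec x)\le e_i(\vec a(\vec x))\implies e_i(\vec a(\vec x))\le e_i(\vec a^2(\vec x)) \] is valid. Then the formula \[ \vec x'=\vec a^n(\vec x)\land\bigwedge_{i=1}^k 0<e_i(\vec x)\le e_i(\vec a(\vec x)) \] approximates $\langle\phi,\vec a\rangle$.
   Context: Fix $d\ge 1$, integer variables $\vec x=(x_1,\dots,x_d)$, $\vec x'$, and $n$ ranging over $\mathbb N$. A loop $\langle\phi,\vec a\rangle$ consists of a quantifier-free formula $\phi$ over atoms $p>0$ ($p$ an arithmetic expression over $\vec x$, integer semantics) and a map $\vec a:\mathbb Z^d\to\mathbb Z^d$ given by expressions over $\vec x$; $\vec a^m$ is $m$-fold application. $\vec x\longrightarrow_{\langle\phi,\vec a\rangle}\vec x'$ iff $\phi(\vec x)\land\vec x'=\vec a(\vec x)$, and $\longrightarrow^m$ is its $m$-fold composition. A formula $\psi$ over $(\vec x,n,\vec x')$ approximates the loop if for all $\vec x,\vec x'\in\mathbb Z^d$ and $n>0$, $\psi$ implies $\vec x\longrightarrow^n_{\langle\phi,\vec a\rangle}\vec x'$. Validity means truth for all integer values of the free variables. -}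

module Defs where

open import Data.Nat using (ℕ; zero; suc)
open import Data.Integer using (ℤ; _+_; _*_; -_; _<_; _≤_; +_)
open import Data.Fin using (Fin)
open import Data.Vec using (Vec; lookup; map)
open import Data.List using (List)
open import Data.List.Relation.Unary.All using (All)
open import Data.List.Relation.Unary.Any using (Any)
open import Data.Product using (_×_; ∃)
open import Relation.Binary.PropositionalEquality using (_≡_)

data Expr (d : ℕ) : Set where
  const : ℤ → Expr d
  var   : Fin d → Expr d
  _⊕_   : Expr d → Expr d → Expr d
  _⊗_   : Expr d → Expr d → Expr d
  ⊖_    : Expr d → Expr d

⟦_⟧ : ∀ {d} → Expr d → Vec ℤ d → ℤ
⟦ const c ⟧ x = c
⟦ var i   ⟧ x = lookup x i
⟦ e ⊕ f   ⟧ x = ⟦ e ⟧ x + ⟦ f ⟧ x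
⟦ e ⊗ f   ⟧ x = ⟦ e ⟧ x * ⟦ f ⟧ x
⟦ ⊖ e     ⟧ x = - ⟦ e ⟧ x

data Lit (d : ℕ) : Set where
  pos : Expr d → Lit d
  neg : Expr d → Lit d

Clause : ℕ → Set
Clause d = List (Lit d)

CNF : ℕ → Set
CNF d = List (Clause d)

⟦_⟧L : ∀ {d} → Lit d → Vec ℤ d → Set
⟦ pos p ⟧L x = + 0 < ⟦ p ⟧ x
⟦ neg p ⟧L x = ⟦ p ⟧ x ≤ + 0

⟦_⟧C : ∀ {d} → Clause d → Vec ℤ d → Set
⟦ C ⟧C x = Any (λ l → ⟦ l ⟧L x) C

⟦_⟧F : ∀ {d} → CNF d → Vec ℤ d → Set
⟦ φ ⟧F x = All (λ C → ⟦ C ⟧C x) φ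

Update : ℕ → Set
Update d = Vec (Expr d) d

apply : ∀ {d} → Update d → Vec ℤ d → Vec ℤ d
apply a x = map (λ e → ⟦ e ⟧ x) a

iter : ∀ {d} → Update d → ℕ → Vec ℤ d → Vec ℤ d
iter a zero    x = x
iter a (suc m) x = apply a (iter a m x)

record Loop (d : ℕ) : Set where
  constructor ⟨_,_⟩
  field
    guard  : CNF d
    update : Update d
open Loop public

Step : ∀ {d} → Loop d → Vec ℤ d → Vec ℤ d → Set
Step L x x' = ⟦ guard L ⟧F x × x' ≡ apply (update L) x

Steps : ∀ {d} → Loop d → ℕ → Vec ℤ d → Vec ℤ d → Set
Steps L zero    x x' = x ≡ x'
Steps L (suc m) x x' = ∃ λ y → Step L x y × Steps L m y x'

-- Positivity of eᵢ together with eᵢ(x) ≤ eᵢ(a(x)) is an invariant of the update: the assumed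
-- implication pushes the increase one step further, and a positive value that does not
-- decrease stays positive. In every state of the run x, a(x), …, aⁿ⁻¹(x) each clause is thus
-- satisfied by its disjunct eᵢ > 0, so every update along the run is a step of the loop.
module Submission where

open import Defs
open import Data.Nat using (ℕ; _≤_; _<_; zero; suc)
open import Data.Integer using (ℤ; +_) renaming (_<_ to _<ℤ_; _≤_ to _≤ℤ_)
open import Data.Integer.Properties using (<-≤-trans)
open import Data.Vec using (Vec)
open import Data.List using (List; _∷_)
open import Data.List.Relation.Unary.All using (All; []; _∷_)
open import Data.List.Relation.Unary.Any as Any using ()
open import Data.List.Relation.Binary.Pointwise using (Pointwise; []; _∷_)
open import Data.List.Membership.Propositional using (_∈_)
open import Data.Product using (_×_; _,_)
open import Relation.Binary.PropositionalEquality using (_≡_; refl; cong; subst)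

iter-apply : ∀ {d} (a : Update d) m (x : Vec ℤ d) → iter a m (apply a x) ≡ apply a (iter a m x)
iter-apply a zero    x = refl
iter-apply a (suc m) x = cong (apply a) (iter-apply a m x)

steps-iter : ∀ {d} (L : Loop d) (I : Vec ℤ d → Set)
  → (∀ {x} → I x → ⟦ guard L ⟧F x)
  → (∀ {x} → I x → I (apply (update L) x))
  → ∀ m {x} → I x → Steps L m x (iter (update L) m x)
steps-iter L I guarded invariant zero    Ix = refl
steps-iter L I guarded invariant (suc m) {x} Ix =
  apply a x , (guarded Ix , refl) ,
  subst (Steps L m (apply a x)) (iter-apply a m x)
        (steps-iter L I guarded invariant m (invariant Ix))
  where a = update L

IncreaseIsSustained : ∀ {d} → Update d → Expr d → Set
IncreaseIsSustained {d} a e =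
  (x : Vec ℤ d) → ⟦ e ⟧ x ≤ℤ ⟦ e ⟧ (apply a x) → ⟦ e ⟧ (apply a x) ≤ℤ ⟦ e ⟧ (apply a (apply a x))

PositiveIncreasing : ∀ {d} → Update d → Vec ℤ d → Expr d → Set
PositiveIncreasing a x e = (+ 0 <ℤ ⟦ e ⟧ x) × (⟦ e ⟧ x ≤ℤ ⟦ e ⟧ (apply a x))

positiveIncreasing-apply : ∀ {d} {a : Update d} {e : Expr d} {x : Vec ℤ d}
  → IncreaseIsSustained a e → PositiveIncreasing a x e → PositiveIncreasing a (apply a x) e
positiveIncreasing-apply {x = x} sustained (positive , increasing) =
  <-≤-trans positive increasing , sustained x increasing

Witnessed : ∀ {d} → Update d → CNF d → List (Expr d) → Set
Witnessed a = Pointwise (λ C e → (pos e ∈ C) × IncreaseIsSustained a e)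

witnessed-guard : ∀ {d} {a : Update d} {φ : CNF d} {es : List (Expr d)} {x : Vec ℤ d}
  → Witnessed a φ es → All (PositiveIncreasing a x) es → ⟦ φ ⟧F x
witnessed-guard []                      []                      = []
witnessed-guard ((e∈C , _) ∷ witnesses) ((positive , _) ∷ invs) =
  Any.map (λ { refl → positive }) e∈C ∷ witnessed-guard witnesses invs

witnessed-invariant : ∀ {d} {a : Update d} {φ : CNF d} {es : List (Expr d)} {x : Vec ℤ d}
  → Witnessed a φ es → All (PositiveIncreasing a x) es → All (PositiveIncreasing a (apply a x)) es
witnessed-invariant []                                            []           = []
witnessed-invariant {es = e ∷ _} ((_ , sustained) ∷ witnesses) (inv ∷ invs) =
  positiveIncreasing-apply {e = e} sustained inv ∷ witnessed-invariant witnesses invs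

theorem12 : (d : ℕ) → 1 ≤ d → (L : Loop d) → (es : List (Expr d))
    → Pointwise (λ C e → (pos e ∈ C)
        × ((x : Vec ℤ d) → ⟦ e ⟧ x ≤ℤ ⟦ e ⟧ (apply (update L) x)
            → ⟦ e ⟧ (apply (update L) x) ≤ℤ ⟦ e ⟧ (apply (update L) (apply (update L) x))))
        (guard L) es
    → (x x' : Vec ℤ d) (n : ℕ) → 0 < n
    → x' ≡ iter (update L) n x
    → All (λ e → (+ 0 <ℤ ⟦ e ⟧ x) × (⟦ e ⟧ x ≤ℤ ⟦ e ⟧ (apply (update L) x))) es
    → Steps L n x x'
theorem12 d _ L es witnesses x x' n _ refl initial =
  steps-iter L (λ y → All (PositiveIncreasing (update L) y) es)
    (witnessed-guard witnesses) (witnessed-invariant witnesses) n initial
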